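{- Let $G$ be a graph with $\mathrm{diam}(G)=4$. Then every independent set of $G$ is a mutual-visibility set if and only if for every pair of vertices $u,v$ with $d_G(u,v)=4$, the induced subgraph $G[I_2[u,v]]$ contains an edge.
   Context: All graphs are finite and simple. For $X\subseteq V(G)$, two vertices $u,v$ are $X$-visible if there is a shortest $u,v$-path $P$ with $V(P)\cap X\subseteq\{u,v\}$; $X$ is a mutual-visibility set if any two vertices of $X$ are $X$-visible. $I_G[u,v]$ is the set of vertices lying on shortest $u,v$-paths, and $I_k[u,v]=\{w\in I_G[u,v]: d_G(u,w)=k\}$. -}

module Defs where

open import Data.Nat using (ℕ; zero; suc; _≤_)
open import Data.Fin using (Fin; zero; suc; fromℕ; inject₁)
open import Data.Fin.Subset using (Subset; _∈_)
open import Data.Bool using (Bool; T)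
open import Data.Product using (Σ; ∃; ∃-syntax; _×_; _,_)
open import Data.Sum using (_⊎_)
open import Relation.Nullary using (¬_)
open import Relation.Binary.PropositionalEquality using (_≡_)

record Graph : Set where
  field
    n     : ℕ
    adj   : Fin n → Fin n → Bool
    irrefl : ∀ v → ¬ T (adj v v)
    sym   : ∀ u v → T (adj u v) → T (adj v u)

module _ (G : Graph) where
  open Graph G

  V : Set
  V = Fin n

  Adj : V → V → Set
  Adj u v = T (adj u v)

  record Walk (u v : V) (k : ℕ) : Set where
    field
      vtx   : Fin (suc k) → V
      start : vtx zero ≡ u
      end   : vtx (fromℕ k) ≡ v
      step  : ∀ (i : Fin k) → Adj (vtx (inject₁ i)) (vtx (suc i))

  Dist : V → V → ℕ → Set
  Dist u v k = Walk u v k × (∀ m → Walk u v m → k ≤ m)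

  Diam : ℕ → Set
  Diam D = (∀ u v → ∃[ k ] (k ≤ D × Dist u v k)) × (∃[ u ] ∃[ v ] Dist u v D)

  -- P is a shortest u,v-path (a walk of length d(u,v); such walks are paths).
  ShortestPath : V → V → Set
  ShortestPath u v = ∃[ k ] (Dist u v k × Walk u v k)

  Visible : Subset n → V → V → Set
  Visible X u v =
    ∃[ k ] (Dist u v k × Σ (Walk u v k) λ P →
      ∀ i → Walk.vtx P i ∈ X → (Walk.vtx P i ≡ u ⊎ Walk.vtx P i ≡ v))

  MutualVisibility : Subset n → Set
  MutualVisibility X = ∀ u v → u ∈ X → v ∈ X → Visible X u v

  Independent : Subset n → Set
  Independent X = ∀ u v → u ∈ X → v ∈ X → ¬ Adj u v

  InInterval : V → V → V → Set
  InInterval u v w =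
    ∃[ k ] (Dist u v k × Σ (Walk u v k) λ P → ∃[ i ] (Walk.vtx P i ≡ w))

  InIntervalLayer : ℕ → V → V → V → Set
  InIntervalLayer j u v w = InInterval u v w × Dist u w j

  LayerHasEdge : ℕ → V → V → Set
  LayerHasEdge j u v =
    ∃[ w ] ∃[ w' ] (InIntervalLayer j u v w × InIntervalLayer j u v w' × Adj w w')

{-# OPTIONS --safe #-}
module Submission where

-- If X is independent and u, v ∈ X, every interior vertex of a shortest u,v-path other than
-- the one at distance 2 from both ends is a neighbour of u or of v, hence outside X. As the
-- diameter is 4, only d(u,v) = 4 matters, and then that middle vertex ranges over I_2[u,v]:
-- if G[I_2[u,v]] has an edge, one of its ends lies outside X, and a shortest path through it
-- witnesses visibility. Conversely, grow an independent S ⊆ I_2[u,v]. Its vertices are at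
-- distance 2 from u and from v, so {u,v} ∪ S is independent and mutual visibility yields a
-- shortest path whose middle vertex p ∈ I_2[u,v] avoids S; either p has a neighbour in S,
-- an edge of G[I_2[u,v]], or S ∪ {p} is a larger independent subset of I_2[u,v].

open import Defs
open import Data.Bool.Properties using (T?)
open import Data.Empty using (⊥-elim)
open import Data.Fin using (Fin; zero; suc; fromℕ; inject₁)
open import Data.Fin.Patterns using (0F; 1F; 2F; 3F; 4F)
open import Data.Fin.Properties using (any?)
open import Data.Fin.Subset using (Subset; _∈_; _∉_; _∪_; ⁅_⁆; ⊥; _⊃_)
open import Data.Fin.Subset.Induction using (Acc; acc; ⊃-wellFounded)
open import Data.Fin.Subset.Properties using (_∈?_; x∈p∪q⁺; x∈p∪q⁻; x∈⁅x⁆; x∈⁅y⁆⇒x≡y; q⊆p∪q; ∉⊥)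
open import Data.Nat using (ℕ; zero; suc; _+_; _≤_; _<_; s≤s; z<s; s<s)
open import Data.Nat.Properties using (≤-antisym; <⇒≱; 1+n≰n; +-cancelʳ-≤; m≤n⇒m<n∨m≡n; ≤-pred)
open import Data.Product using (Σ; ∃-syntax; _×_; _,_; proj₁; proj₂)
open import Data.Sum using (_⊎_; inj₁; inj₂; [_,_]; map₁)
open import Function using (_∘_)
open import Relation.Nullary using (¬_; yes; no)
open import Relation.Nullary.Decidable using (_×-dec_)
open import Relation.Unary using (_⊆_)
open import Relation.Binary.PropositionalEquality using (_≡_; _≢_; refl; sym; trans; subst; subst₂)

∈⁅⁆∪⁻ : ∀ {m} {x y : Fin m} {S : Subset m} → x ∈ ⁅ y ⁆ ∪ S → x ≡ y ⊎ x ∈ S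
∈⁅⁆∪⁻ {y = y} {S} x∈ = map₁ (x∈⁅y⁆⇒x≡y y) (x∈p∪q⁻ ⁅ y ⁆ S x∈)

module _ (G : Graph) where
  open Graph G using (n; adj; irrefl) renaming (sym to adj-sym)
  open Walk

  private
    variable
      u v w x : V G
      k m a b : ℕ

  infixr 5 _∷_ _++_

  data Steps : V G → V G → ℕ → Set where
    []  : Steps u u 0
    _∷_ : Adj G u w → Steps w v k → Steps u v (suc k)

  _++_ : Steps u x a → Steps x v b → Steps u v (a + b)
  [] ++ q = q
  (e ∷ p) ++ q = e ∷ (p ++ q)

  vertex : Steps u v k → Fin (suc k) → V G
  vertex {u} _ zero = u
  vertex (_ ∷ p) (suc i) = vertex p i

  toWalk : Steps u v k → Walk G u v k
  toWalk p = record { vtx = vertex p ; start = refl ; end = vertex-end p ; step = vertex-step p }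
    where
    vertex-end : (p : Steps u v k) → vertex p (fromℕ k) ≡ v
    vertex-end [] = refl
    vertex-end (_ ∷ p) = vertex-end p

    vertex-step : (p : Steps u v k) (i : Fin k) → Adj G (vertex p (inject₁ i)) (vertex p (suc i))
    vertex-step (e ∷ _) zero = e
    vertex-step (_ ∷ p) (suc i) = vertex-step p i

  stepsOf : (f : Fin (suc k) → V G) → (∀ i → Adj G (f (inject₁ i)) (f (suc i))) →
            Steps (f zero) (f (fromℕ k)) k
  stepsOf {zero} f s = []
  stepsOf {suc k} f s = s zero ∷ stepsOf (f ∘ suc) (s ∘ suc)

  fromWalk : Walk G u v k → Steps u v k
  fromWalk P = subst₂ (λ a b → Steps a b _) (start P) (end P) (stepsOf (vtx P) (step P))

  first-step : (P : Walk G u v (suc k)) → Adj G u (vtx P 1F)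
  first-step P = subst (λ x → Adj G x (vtx P 1F)) (start P) (step P 0F)

  last-step : (P : Walk G u v (suc k)) → Adj G (vtx P (inject₁ (fromℕ k))) v
  last-step P = subst (Adj G _) (end P) (step P (fromℕ _))

  Dist-unique : Dist G u v k → Dist G u v m → k ≡ m
  Dist-unique (P , minP) (Q , minQ) = ≤-antisym (minP _ Q) (minQ _ P)

  Dist-≤-via : Dist G u v k → Walk G u x a → Walk G x v b → k ≤ a + b
  Dist-≤-via (_ , minimal) P Q = minimal _ (toWalk (fromWalk P ++ fromWalk Q))

  Dist⇒≢ : Dist G u v (suc k) → u ≢ v
  Dist⇒≢ (_ , minimal) refl = <⇒≱ z<s (minimal 0 (toWalk []))

  Dist⇒¬Adj : Dist G u v k → 1 < k → ¬ Adj G u v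
  Dist⇒¬Adj (_ , minimal) 1<k e = <⇒≱ 1<k (minimal 1 (toWalk (e ∷ [])))

  independent-insert : ∀ {S} → Independent G S → (∀ {t} → t ∈ S → ¬ Adj G x t) →
                       Independent G (⁅ x ⁆ ∪ S)
  independent-insert {x} ind x≁S a b a∈ b∈ with ∈⁅⁆∪⁻ a∈ | ∈⁅⁆∪⁻ b∈
  ... | inj₁ refl | inj₁ refl = irrefl x
  ... | inj₁ refl | inj₂ b∈S  = x≁S b∈S
  ... | inj₂ a∈S  | inj₁ refl = x≁S a∈S ∘ adj-sym a x
  ... | inj₂ a∈S  | inj₂ b∈S  = ind a b a∈S b∈S

  Independent⇒endpoint-∉ : ∀ {X} → Independent G X → Adj G w x → w ∉ X ⊎ x ∉ X
  Independent⇒endpoint-∉ {w} {x} {X} ind e with w ∈? X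
  ... | yes w∈X = inj₂ λ x∈X → ind w x w∈X x∈X e
  ... | no w∉X  = inj₁ w∉X

  module _ (d : Dist G u v 4) where

    halfway-≢-end : Dist G u w 2 → w ≢ v
    halfway-≢-end d₂ w≡v with Dist-unique (subst (λ y → Dist G u y 2) w≡v d₂) d
    ... | ()

    halfway-¬Adj-end : Dist G u w 2 → ¬ Adj G w v
    halfway-¬Adj-end (P , _) e = 1+n≰n (Dist-≤-via d P (toWalk (e ∷ [])))

    middle-dist : (P : Walk G u v 4) → Dist G u (vtx P 2F) 2
    middle-dist P = toWalk (first-step P ∷ step P 1F ∷ []) , minimal
      where
      minimal : ∀ m → Walk G u (vtx P 2F) m → 2 ≤ m
      minimal m Q = +-cancelʳ-≤ 2 2 m (Dist-≤-via d Q (toWalk (step P 2F ∷ last-step P ∷ [])))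

    layer-middle : InIntervalLayer G 2 u v w → Σ (Walk G u v 4) λ Q → vtx Q 2F ≡ w
    layer-middle {w} ((k , dₖ , Q , i , Qi≡w) , d₂) with Dist-unique dₖ d
    ... | refl = at i Qi≡w
      where
      at : ∀ i → vtx Q i ≡ w → Σ (Walk G u v 4) λ Q → vtx Q 2F ≡ w
      at 0F Q0≡w = ⊥-elim (Dist⇒≢ d₂ (trans (sym (start Q)) Q0≡w))
      at 1F Q1≡w = ⊥-elim (Dist⇒¬Adj d₂ (s<s z<s) (subst (Adj G u) Q1≡w (first-step Q)))
      at 2F Q2≡w = Q , Q2≡w
      at 3F Q3≡w = ⊥-elim (halfway-¬Adj-end d₂ (subst (λ y → Adj G y v) Q3≡w (last-step Q)))
      at 4F Q4≡w = ⊥-elim (halfway-≢-end d₂ (trans (sym Q4≡w) (end Q)))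

    ends-∪-independent : ∀ {S} → (_∈ S) ⊆ InIntervalLayer G 2 u v → Independent G S →
                         Independent G (⁅ u ⁆ ∪ (⁅ v ⁆ ∪ S))
    ends-∪-independent {S} S⊆I ind = independent-insert (independent-insert ind v≁S) u≁vS
      where
      v≁S : ∀ {t} → t ∈ S → ¬ Adj G v t
      v≁S t∈S = halfway-¬Adj-end (proj₂ (S⊆I t∈S)) ∘ adj-sym v _
      u≁vS : ∀ {t} → t ∈ ⁅ v ⁆ ∪ S → ¬ Adj G u t
      u≁vS t∈ with ∈⁅⁆∪⁻ t∈
      ... | inj₁ refl = Dist⇒¬Adj d (s<s z<s)
      ... | inj₂ t∈S  = Dist⇒¬Adj (proj₂ (S⊆I t∈S)) (s<s z<s)

  InteriorAvoids : Subset n → Walk G u v k → Set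
  InteriorAvoids {u} {v} X P = ∀ i → vtx P i ∈ X → vtx P i ≡ u ⊎ vtx P i ≡ v

  module _ {X} (ind : Independent G X) (u∈X : u ∈ X) (v∈X : v ∈ X) where

    short-walk-avoids : k ≤ 3 → (P : Walk G u v k) → InteriorAvoids X P
    short-walk-avoids _ P 0F _ = inj₁ (start P)
    short-walk-avoids {1} _ P 1F _ = inj₂ (end P)
    short-walk-avoids {2} _ P 1F x∈X = ⊥-elim (ind u _ u∈X x∈X (first-step P))
    short-walk-avoids {2} _ P 2F _ = inj₂ (end P)
    short-walk-avoids {3} _ P 1F x∈X = ⊥-elim (ind u _ u∈X x∈X (first-step P))
    short-walk-avoids {3} _ P 2F x∈X = ⊥-elim (ind _ v x∈X v∈X (last-step P))
    short-walk-avoids {3} _ P 3F _ = inj₂ (end P)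
    short-walk-avoids {suc (suc (suc (suc _)))} (s≤s (s≤s (s≤s ())))

    middle-free-walk-avoids : (P : Walk G u v 4) → vtx P 2F ∉ X → InteriorAvoids X P
    middle-free-walk-avoids P _ 0F _ = inj₁ (start P)
    middle-free-walk-avoids P _ 1F x∈X = ⊥-elim (ind u _ u∈X x∈X (first-step P))
    middle-free-walk-avoids P mid∉X 2F mid∈X = ⊥-elim (mid∉X mid∈X)
    middle-free-walk-avoids P _ 3F x∈X = ⊥-elim (ind _ v x∈X v∈X (last-step P))
    middle-free-walk-avoids P _ 4F _ = inj₂ (end P)

    visible-at-distance-4 : Dist G u v 4 → LayerHasEdge G 2 u v → Visible G X u v
    visible-at-distance-4 d (w , w' , w∈I , w'∈I , e) =
      [ through w∈I , through w'∈I ] (Independent⇒endpoint-∉ ind e)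
      where
      through : InIntervalLayer G 2 u v x → x ∉ X → Visible G X u v
      through x∈I x∉X with layer-middle d x∈I
      ... | Q , Q2≡x = 4 , d , Q , middle-free-walk-avoids Q (x∉X ∘ subst (_∈ X) Q2≡x)

  -- Q need not be decidable: the missing vertex is supplied by the hypothesis, and the
  -- search is only over the finite S.
  independent-subsets-proper⇒edge : (Q : V G → Set) →
    (∀ S → (_∈ S) ⊆ Q → Independent G S → ∃[ p ] (Q p × p ∉ S)) →
    ∃[ p ] ∃[ t ] (Q p × Q t × Adj G p t)
  independent-subsets-proper⇒edge Q missed =
    grow ⊥ (⊃-wellFounded ⊥) (⊥-elim ∘ ∉⊥) (λ _ _ t∈⊥ → ⊥-elim (∉⊥ t∈⊥))
    where
    grow : ∀ S → Acc _⊃_ S → (_∈ S) ⊆ Q → Independent G S → ∃[ p ] ∃[ t ] (Q p × Q t × Adj G p t)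
    grow S (acc larger) S⊆Q ind with missed S S⊆Q ind
    ... | p , Qp , p∉S with any? (λ t → t ∈? S ×-dec T? (adj p t))
    ...   | yes (t , t∈S , e) = p , t , Qp , S⊆Q t∈S , e
    ...   | no p≁S =
      grow (⁅ p ⁆ ∪ S) (larger (q⊆p∪q ⁅ p ⁆ S , p , x∈p∪q⁺ (inj₁ (x∈⁅x⁆ p)) , p∉S))
           ([ (λ { refl → Qp }) , S⊆Q ] ∘ ∈⁅⁆∪⁻)
           (independent-insert ind (λ t∈S e → p≁S (_ , t∈S , e)))

  mutualVisibility⇒layer-edge : (∀ X → Independent G X → MutualVisibility G X) →
                                Dist G u v 4 → LayerHasEdge G 2 u v
  mutualVisibility⇒layer-edge {u} {v} mv d =
    independent-subsets-proper⇒edge (InIntervalLayer G 2 u v) middle-outside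
    where
    middle-outside : ∀ S → (_∈ S) ⊆ InIntervalLayer G 2 u v → Independent G S →
                     ∃[ p ] (InIntervalLayer G 2 u v p × p ∉ S)
    middle-outside S S⊆I ind
      with mv (⁅ u ⁆ ∪ (⁅ v ⁆ ∪ S)) (ends-∪-independent d S⊆I ind) u v
              (x∈p∪q⁺ (inj₁ (x∈⁅x⁆ u))) (x∈p∪q⁺ (inj₂ (x∈p∪q⁺ (inj₁ (x∈⁅x⁆ v)))))
    ... | k , dₖ , P , avoids with Dist-unique dₖ d
    ...   | refl = vtx P 2F , ((4 , d , P , 2F , refl) , d₂) , mid∉S
      where
      d₂ = middle-dist d P
      mid∉S : vtx P 2F ∉ S
      mid∉S mid∈S = [ Dist⇒≢ d₂ ∘ sym , halfway-≢-end d d₂ ]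
                      (avoids 2F (x∈p∪q⁺ (inj₂ (x∈p∪q⁺ (inj₂ mid∈S)))))

  layer-edges⇒mutualVisibility : Diam G 4 → (∀ u v → Dist G u v 4 → LayerHasEdge G 2 u v) →
                                 ∀ X → Independent G X → MutualVisibility G X
  layer-edges⇒mutualVisibility (bounded , _) edges X ind u v u∈X v∈X with bounded u v
  ... | k , k≤4 , d with m≤n⇒m<n∨m≡n k≤4
  ...   | inj₁ k<4 = k , d , proj₁ d , short-walk-avoids ind u∈X v∈X (≤-pred k<4) (proj₁ d)
  ...   | inj₂ refl = visible-at-distance-4 ind u∈X v∈X d (edges u v d)

corollary5p2 : (G : Graph) → Diam G 4 →
    ((∀ (X : Subset (Graph.n G)) → Independent G X → MutualVisibility G X)
      → (∀ u v → Dist G u v 4 → LayerHasEdge G 2 u v))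
    × ((∀ u v → Dist G u v 4 → LayerHasEdge G 2 u v)
      → (∀ (X : Subset (Graph.n G)) → Independent G X → MutualVisibility G X))
corollary5p2 G diam =
  (λ mv u v → mutualVisibility⇒layer-edge G mv) , layer-edges⇒mutualVisibility G diam
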